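{- For every integer $k\geq 1$ there exist a $(2k+1)$-graph $G$ and a perfect matching $F$ of $G$ such that for any $2k$ perfect matchings $F_1,\dots,F_{2k}$ of $G$ there are indices $1\leq i<j\leq 2k$ with $F\cap F_i\cap F_j\neq\emptyset$.
   Context: All graphs are finite and connected; multiple edges are allowed but loops are not. For a vertex set $X\subseteq V$, $\partial(X)$ denotes the set of edges with exactly one end in $X$; $X$ is odd if $|X|$ is odd. An $r$-graph is an $r$-regular graph $G=(V,E)$ such that $|\partial(X)|\geq r$ for every odd set $X\subseteq V$. -}

module Defs where

open import Data.Nat using (ℕ; suc; _%_; _≥_)
open import Data.Fin using (Fin; _≟_)
open import Data.Fin.Subset using (Subset; ∣_∣; _∩_)
open import Data.Vec using (tabulate; lookup)
open import Data.Bool using (Bool; _∨_; _xor_)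
open import Data.Product using (_×_)
open import Relation.Nullary using (¬_; does)
open import Relation.Binary.PropositionalEquality using (_≡_; _≢_)

record Graph : Set where
  field
    n      : ℕ
    m      : ℕ
    src    : Fin m → Fin n
    tgt    : Fin m → Fin n
    noLoop : ∀ e → src e ≢ tgt e

module _ (G : Graph) where
  open Graph G

  incident : Fin n → Subset m
  incident v = tabulate (λ e → does (src e ≟ v) ∨ does (tgt e ≟ v))

  degree : Fin n → ℕ
  degree v = ∣ incident v ∣

  ∂ : Subset n → Subset m
  ∂ X = tabulate (λ e → lookup X (src e) xor lookup X (tgt e))

  Odd : Subset n → Set
  Odd X = ∣ X ∣ % 2 ≡ 1

  data Reachable : Fin n → Fin n → Set where
    here  : ∀ {v} → Reachable v v
    fwd   : ∀ {u} e → Reachable (tgt e) u → Reachable (src e) u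
    bwd   : ∀ {u} e → Reachable (src e) u → Reachable (tgt e) u

  Connected : Set
  Connected = ∀ u v → Reachable u v

  Regular : ℕ → Set
  Regular r = ∀ v → degree v ≡ r

  PerfectMatching : Subset m → Set
  PerfectMatching F = ∀ v → ∣ F ∩ incident v ∣ ≡ 1

IsRGraph : ℕ → Graph → Set
IsRGraph r G =
  Connected G × Regular G r × (∀ X → Odd G X → ∣ ∂ G X ∣ ≥ r)

module Submission where

-- Gₖ arises from the Petersen graph by replacing each spoke by 2k − 1 parallel edges and each vertex
-- by a "blob", a cycle of length 2k + 1 whose edges have multiplicity k, the 2k + 1 edges formerly at
-- the vertex now ending at distinct blob vertices. Gₖ is (2k + 1)-regular, and the edges coming from
-- the Petersen graph form a perfect matching F. An odd cut either splits a blob, which costs 2k blob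
-- edges, or is an odd cut of the Petersen graph with spokes of weight 2k − 1, which costs at least
-- 2k + 1; parity of odd cuts in an odd-regular graph closes the gap in the first case.
-- If perfect matchings F₁, …, F₂ₖ were pairwise disjoint on F, each would cross the boundary of every
-- blob an odd number of times; since these boundaries have only 2k + 1 edges, every Fᵢ, and the set U
-- of edges of F used by no Fᵢ, crosses each boundary exactly once, and so induces a perfect matching
-- of the Petersen graph. Such a matching uses an even number of edges of the outer 5-cycle, whereas
-- U, F₁, …, F₂ₖ together use each of these 5 edges exactly once.

open import Data.Bool using (Bool; true; false; _∧_; _∨_; _xor_; not)
import Data.Bool.Properties as B
open import Data.Empty using (⊥; ⊥-elim)
open import Data.Fin
  using (Fin; zero; suc; _<_; _↑ˡ_; _↑ʳ_; combine; remQuot; quotient; splitAt; _≟_; toℕ; fromℕ; inject₁; lower₁)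
open import Data.Fin.Induction using (<-weakInduction; <-weakInduction-startingFrom)
open import Data.Fin.Patterns
open import Data.Fin.Properties
  using ( toℕ-fromℕ; toℕ-inject₁-≢; lower₁-inject₁′; inject₁-lower₁; toℕ-lower₁; toℕ-injective; ≤fromℕ
        ; any?; all?; splitAt-↑ˡ; splitAt-↑ʳ; combine-injective; remQuot-combine; combine-remQuot)
import Data.Fin.Properties as Fin
open import Data.Fin.Subset using (Subset; ∣_∣; _∩_; _∈_; Nonempty)
open import Data.Fin.Subset.Properties using (anySubset?; nonempty?; x∈p∩q⁺)
open import Data.Nat using (ℕ; zero; suc; _+_; _*_; _≤_; _≤?_; z≤n; s≤s; _%_; parity)
import Data.Nat as ℕ
open import Data.Nat.Properties
  using ( +-*-semiring; +-commutativeSemigroup; module ≤-Reasoning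
        ; +-identityʳ; *-identityˡ; *-identityʳ; *-zeroʳ; +-assoc; +-comm; *-comm; +-suc
        ; *-distribˡ-+; *-distribʳ-+; +-cancelʳ-≡; +-cancelʳ-≤; suc-injective; 0≢1+n; 1+n≢n
        ; ≤-reflexive; ≤-trans; n≤1+n; m≤m+n; m≤n+m; +-mono-≤; +-monoʳ-≤; *-monoʳ-≤; ≤∧≢⇒<)
open import Data.Nat.Tactic.RingSolver using (solve-∀)
open import Algebra.Properties.CommutativeSemigroup +-commutativeSemigroup
  using () renaming (interchange to +-interchange)
open import Algebra.Properties.Semiring.Sum +-*-semiring
  using (sum; sum-syntax; ∑-comm; *-distribʳ-sum)
  renaming (sum-cong-≗ to ∑-cong; ∑-distrib-+ to ∑-+; *-distribˡ-sum to ∑-*ˡ)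
open import Data.Parity.Base using (0ℙ; 1ℙ) renaming (_+_ to _+ℙ_; _*_ to _*ℙ_)
open import Data.Parity.Properties using (+-homo-+; *-homo-*)
import Data.Parity.Properties as ℙ
open import Data.Product using (Σ; ∃; _×_; _,_; proj₁; proj₂; uncurry)
open import Data.Sum using ([_,_]′)
open import Data.Vec using ([]; _∷_; lookup; tabulate)
open import Data.Vec.Properties using (lookup-zipWith; lookup∘tabulate; lookup⇒[]=)
open import Function using (id; _∘_)
open import Function.Bundles using (mk⇔)
open import Relation.Binary.Definitions using (Tri; tri<; tri≈; tri>)
open import Relation.Binary.PropositionalEquality
open import Relation.Nullary using (Dec; ¬_; ¬?; does; yes; no; contradiction)
open import Relation.Nullary.Decidable
  using (does-⇔; _×-dec_; _→-dec_; from-yes; from-no; decidable-stable)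
open import Relation.Unary using (Pred; Decidable)

open import Defs

-- Finite sums

𝟙 : Bool → ℕ
𝟙 true  = 1
𝟙 false = 0

𝟙-∧ : ∀ x y → 𝟙 (x ∧ y) ≡ 𝟙 x * 𝟙 y
𝟙-∧ true  y = sym (+-identityʳ (𝟙 y))
𝟙-∧ false y = refl

∑-const : ∀ n c → ∑[ i < n ] c ≡ n * c
∑-const zero    c = refl
∑-const (suc n) c = cong (c +_) (∑-const n c)

∑-zero : ∀ n → ∑[ i < n ] 0 ≡ 0
∑-zero n = trans (∑-const n 0) (*-zeroʳ n)

∑-↑ : ∀ m n (f : Fin (m + n) → ℕ) →
      sum f ≡ ∑[ i < m ] f (i ↑ˡ n) + ∑[ j < n ] f (m ↑ʳ j)
∑-↑ zero    n f = refl
∑-↑ (suc m) n f = trans (cong (f zero +_) (∑-↑ m n (f ∘ suc))) (sym (+-assoc (f zero) _ _))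

∑-combine : ∀ m n (f : Fin (m * n) → ℕ) → sum f ≡ ∑[ i < m ] ∑[ j < n ] f (combine i j)
∑-combine zero    n f = refl
∑-combine (suc m) n f =
  trans (∑-↑ n (m * n) f) (cong (∑[ j < n ] f (j ↑ˡ (m * n)) +_) (∑-combine m n (f ∘ (n ↑ʳ_))))

∑-indicator : ∀ {n} (a : Fin n) (g : Fin n → ℕ) → ∑[ j < n ] (𝟙 (does (a ≟ j)) * g j) ≡ g a
∑-indicator {suc n} zero    g = trans (cong₂ _+_ (*-identityˡ (g zero)) (∑-zero n)) (+-identityʳ (g zero))
∑-indicator {suc n} (suc a) g = ∑-indicator a (g ∘ suc)

≟-sym-does : ∀ {n} (a b : Fin n) → does (a ≟ b) ≡ does (b ≟ a)
≟-sym-does a b = does-⇔ (mk⇔ sym sym) (a ≟ b) (b ≟ a)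

∑-indicator′ : ∀ {n} (a : Fin n) (g : Fin n → ℕ) → ∑[ j < n ] (𝟙 (does (j ≟ a)) * g j) ≡ g a
∑-indicator′ a g = trans (∑-cong λ j → cong (λ x → 𝟙 x * g j) (≟-sym-does j a)) (∑-indicator a g)

∑-point : ∀ {n} (a : Fin n) → ∑[ j < n ] 𝟙 (does (j ≟ a)) ≡ 1
∑-point a = trans (∑-cong λ j → sym (*-identityʳ (𝟙 (does (j ≟ a))))) (∑-indicator′ a (λ _ → 1))

∑-preimage : ∀ {n} (f g : Fin n → Fin n) → (∀ a → f (g a) ≡ a) → (∀ i → g (f i) ≡ i) →
             ∀ a → ∑[ i < n ] 𝟙 (does (f i ≟ a)) ≡ 1
∑-preimage f g fg gf a = trans (∑-cong λ i → cong 𝟙 (does-⇔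
    (mk⇔ (λ fi≡a → trans (sym (gf i)) (cong g fi≡a)) (λ i≡ga → trans (cong f i≡ga) (fg a)))
    (f i ≟ a) (i ≟ g a)))
  (∑-point (g a))

∑-mono-≤ : ∀ {n} {f g : Fin n → ℕ} → (∀ i → f i ≤ g i) → sum f ≤ sum g
∑-mono-≤ {zero}  f≤g = z≤n
∑-mono-≤ {suc n} f≤g = +-mono-≤ (f≤g zero) (∑-mono-≤ (f≤g ∘ suc))

∑-point-≤ : ∀ {n} (f : Fin n → ℕ) i → f i ≤ sum f
∑-point-≤ f zero    = m≤m+n _ _
∑-point-≤ f (suc i) = ≤-trans (∑-point-≤ (f ∘ suc) i) (m≤n+m _ (f zero))

∑-two-points-≤ : ∀ {n} (f : Fin n → ℕ) {i j} → i ≢ j → f i + f j ≤ sum f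
∑-two-points-≤ f {zero}  {zero}  i≢j = contradiction refl i≢j
∑-two-points-≤ f {zero}  {suc j} i≢j = +-monoʳ-≤ (f zero) (∑-point-≤ (f ∘ suc) j)
∑-two-points-≤ f {suc i} {zero}  i≢j =
  subst (_≤ sum f) (+-comm (f zero) (f (suc i))) (+-monoʳ-≤ (f zero) (∑-point-≤ (f ∘ suc) i))
∑-two-points-≤ f {suc i} {suc j} i≢j =
  ≤-trans (∑-two-points-≤ (f ∘ suc) (i≢j ∘ cong suc)) (m≤n+m _ (f zero))

∑-*ʳ : ∀ {n} (f : Fin n → ℕ) c → ∑[ i < n ] (f i * c) ≡ sum f * c
∑-*ʳ f c = sym (*-distribʳ-sum c f)

∑-product : ∀ {m n} (f : Fin m → ℕ) (g : Fin n → ℕ) → ∑[ i < m ] ∑[ j < n ] (f i * g j) ≡ sum f * sum g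
∑-product f g = trans (∑-cong λ i → sym (∑-*ˡ (f i) g)) (∑-*ʳ f (sum g))

∑-exclusive-≤1 : ∀ {n} (f : Fin n → Bool) → (∀ {i j} → f i ≡ true → f j ≡ true → i ≡ j) →
                 ∑[ i < n ] 𝟙 (f i) ≤ 1
∑-exclusive-≤1 {zero}  f exclusive = z≤n
∑-exclusive-≤1 {suc n} f exclusive with f zero in f₀
... | false = ∑-exclusive-≤1 (f ∘ suc) λ fi fj → Fin.suc-injective (exclusive fi fj)
... | true  = ≤-reflexive (cong suc (trans (∑-cong (cong 𝟙 ∘ rest-false)) (∑-zero n)))
  where
  rest-false : ∀ i → f (suc i) ≡ false
  rest-false i with f (suc i) in fᵢ
  ... | true  = contradiction (exclusive f₀ fᵢ) λ ()
  ... | false = refl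

𝟙[≡ᵇ0]+≡1 : ∀ {n} → n ≤ 1 → 𝟙 (n ℕ.≡ᵇ 0) + n ≡ 1
𝟙[≡ᵇ0]+≡1 {0} _ = refl
𝟙[≡ᵇ0]+≡1 {1} _ = refl
𝟙[≡ᵇ0]+≡1 {suc (suc n)} (s≤s ())

𝟙-∧-split : ∀ {n} a x (y : Fin n → Bool) → 𝟙 x + ∑[ i < n ] 𝟙 (y i) ≡ 1 →
            𝟙 (a ∧ x) + ∑[ i < n ] 𝟙 (a ∧ y i) ≡ 𝟙 a
𝟙-∧-split {n} true  x y split = split
𝟙-∧-split {n} false x y split = ∑-zero n

∣p∣≡∑ : ∀ {n} (p : Subset n) → ∣ p ∣ ≡ ∑[ i < n ] 𝟙 (lookup p i)
∣p∣≡∑ []          = refl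
∣p∣≡∑ (true ∷ p)  = cong suc (∣p∣≡∑ p)
∣p∣≡∑ (false ∷ p) = ∣p∣≡∑ p

∣tabulate∣ : ∀ {n} (f : Fin n → Bool) → ∣ tabulate f ∣ ≡ ∑[ i < n ] 𝟙 (f i)
∣tabulate∣ f = trans (∣p∣≡∑ (tabulate f)) (∑-cong (cong 𝟙 ∘ lookup∘tabulate f))

∣∩tabulate∣ : ∀ {n} (p : Subset n) (f : Fin n → Bool) →
              ∣ p ∩ tabulate f ∣ ≡ ∑[ i < n ] 𝟙 (lookup p i ∧ f i)
∣∩tabulate∣ p f = trans (∣p∣≡∑ (p ∩ tabulate f)) (∑-cong λ i →
  cong 𝟙 (trans (lookup-zipWith _∧_ i p (tabulate f)) (cong (lookup p i ∧_) (lookup∘tabulate f i))))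


-- Parity

parity-2*+ : ∀ a b → parity (2 * a + b) ≡ parity b
parity-2*+ a b = trans (+-homo-+ (2 * a) b) (cong (_+ℙ parity b) (*-homo-* 2 a))

%2≡1⇒parity≡1ℙ : ∀ n → n % 2 ≡ 1 → parity n ≡ 1ℙ
%2≡1⇒parity≡1ℙ 1             _ = refl
%2≡1⇒parity≡1ℙ (suc (suc n)) h = %2≡1⇒parity≡1ℙ n h

odd-above-even : ∀ {n} a → parity n ≡ 1ℙ → 2 * a ≤ n → 2 * a + 1 ≤ n
odd-above-even {n} a odd 2a≤n = subst (_≤ n) (+-comm 1 (2 * a)) (≤∧≢⇒< 2a≤n λ 2a≡n →
  contradiction (trans (sym (*-homo-* 2 a)) (trans (cong parity 2a≡n) odd)) λ ())

weighted-sum-≥ : ∀ {a b} s → 1 ≤ b → 3 ≤ a + b → 3 + s ≤ a + suc s * b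
weighted-sum-≥ {a} {b} s 1≤b 3≤a+b = begin
  3 + s           ≤⟨ +-mono-≤ 3≤a+b (≤-trans (≤-reflexive (sym (*-identityʳ s))) (*-monoʳ-≤ s 1≤b)) ⟩
  a + b + s * b   ≡⟨ +-assoc a b (s * b) ⟩
  a + suc s * b   ∎
  where open ≤-Reasoning

parity-∑-even : ∀ {n} (f : Fin n → ℕ) → (∀ i → parity (f i) ≡ 0ℙ) → parity (sum f) ≡ 0ℙ
parity-∑-even {zero}  f even = refl
parity-∑-even {suc n} f even =
  trans (+-homo-+ (f zero) (sum (f ∘ suc))) (cong₂ _+ℙ_ (even zero) (parity-∑-even (f ∘ suc) (even ∘ suc)))

odd⇒≥1 : ∀ {a} → parity a ≡ 1ℙ → 1 ≤ a
odd⇒≥1 {suc a} _ = s≤s z≤n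

odd-≤2⇒≡1 : ∀ {a} → parity a ≡ 1ℙ → a ≤ 2 → a ≡ 1
odd-≤2⇒≡1 {1}                   _ _ = refl
odd-≤2⇒≡1 {suc (suc (suc a))}   _ (s≤s (s≤s ()))

odd-parts-tight : ∀ {n} u (a : Fin n → ℕ) → (∀ i → parity (a i) ≡ 1ℙ) →
                  u + sum a ≡ suc n → u ≡ 1 × (∀ i → a i ≡ 1)
odd-parts-tight {zero}  u a odd total = trans (sym (+-identityʳ u)) total , λ ()
odd-parts-tight {suc n} u a odd total = proj₁ rest , λ { zero → a₀≡1 ; (suc i) → proj₂ rest i }
  where
  n≤rest : n ≤ sum (a ∘ suc)
  n≤rest = subst (_≤ sum (a ∘ suc)) (trans (∑-const n 1) (*-identityʳ n)) (∑-mono-≤ (odd⇒≥1 ∘ odd ∘ suc))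
  a₀≤2 : a zero ≤ 2
  a₀≤2 = +-cancelʳ-≤ n (a zero) 2 (begin
    a zero + n                    ≤⟨ +-monoʳ-≤ (a zero) n≤rest ⟩
    a zero + sum (a ∘ suc)        ≤⟨ m≤n+m _ u ⟩
    u + (a zero + sum (a ∘ suc))  ≡⟨ total ⟩
    2 + n                         ∎)
    where open ≤-Reasoning
  a₀≡1 : a zero ≡ 1
  a₀≡1 = odd-≤2⇒≡1 (odd zero) a₀≤2
  rest-total : u + sum (a ∘ suc) ≡ suc n
  rest-total = suc-injective (trans (sym (+-suc u (sum (a ∘ suc))))
    (subst (λ a₀ → u + (a₀ + sum (a ∘ suc)) ≡ suc (suc n)) a₀≡1 total))
  rest : u ≡ 1 × (∀ i → a (suc i) ≡ 1)
  rest = odd-parts-tight u (a ∘ suc) (odd ∘ suc) rest-total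


-- Graphs

module _ (G : Graph) where
  open Graph G

  isIncident : Fin n → Fin m → Bool
  isIncident v e = does (src e ≟ v) ∨ does (tgt e ≟ v)

  crosses : (Fin n → Bool) → Fin m → Bool
  crosses X e = X (src e) xor X (tgt e)

  inside : (Fin n → Bool) → Fin m → Bool
  inside X e = X (src e) ∧ X (tgt e)

  𝟙-isIncident : ∀ s e v → 𝟙 (s ∧ isIncident v e) ≡ 𝟙 s * (𝟙 (does (src e ≟ v)) + 𝟙 (does (tgt e ≟ v)))
  𝟙-isIncident s e v with src e ≟ v | tgt e ≟ v
  ... | yes s≡v | yes t≡v = contradiction (trans s≡v (sym t≡v)) (noLoop e)
  𝟙-isIncident true  e v | yes _ | no _ = refl
  𝟙-isIncident false e v | yes _ | no _ = refl
  𝟙-isIncident true  e v | no _ | yes _ = refl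
  𝟙-isIncident false e v | no _ | yes _ = refl
  𝟙-isIncident true  e v | no _ | no _ = refl
  𝟙-isIncident false e v | no _ | no _ = refl

  private
    endpoints : ∀ s x y → 𝟙 s * (𝟙 x + 𝟙 y) ≡ 2 * 𝟙 (s ∧ (x ∧ y)) + 𝟙 (s ∧ (x xor y))
    endpoints true  true  true  = refl
    endpoints true  true  false = refl
    endpoints true  false true  = refl
    endpoints true  false false = refl
    endpoints false x     y     = refl

    at-edge : ∀ (X : Fin n → Bool) (S : Fin m → Bool) e →
              ∑[ v < n ] (𝟙 (X v) * 𝟙 (S e ∧ isIncident v e))
              ≡ 2 * 𝟙 (S e ∧ inside X e) + 𝟙 (S e ∧ crosses X e)
    at-edge X S e = begin
      ∑[ v < n ] (𝟙 (X v) * 𝟙 (S e ∧ isIncident v e))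
        ≡⟨ ∑-cong (λ v → trans (cong (𝟙 (X v) *_) (𝟙-isIncident (S e) e v))
             (rearrange (𝟙 (X v)) (𝟙 (S e)) (𝟙 (does (src e ≟ v))) (𝟙 (does (tgt e ≟ v))))) ⟩
      ∑[ v < n ] (𝟙 (S e) * (𝟙 (does (src e ≟ v)) * 𝟙 (X v) + 𝟙 (does (tgt e ≟ v)) * 𝟙 (X v)))
        ≡⟨ sym (∑-*ˡ (𝟙 (S e)) (λ v → 𝟙 (does (src e ≟ v)) * 𝟙 (X v) + 𝟙 (does (tgt e ≟ v)) * 𝟙 (X v))) ⟩
      𝟙 (S e) * ∑[ v < n ] (𝟙 (does (src e ≟ v)) * 𝟙 (X v) + 𝟙 (does (tgt e ≟ v)) * 𝟙 (X v))
        ≡⟨ cong (𝟙 (S e) *_) (trans (∑-+ (λ v → 𝟙 (does (src e ≟ v)) * 𝟙 (X v)) (λ v → 𝟙 (does (tgt e ≟ v)) * 𝟙 (X v)))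
             (cong₂ _+_ (∑-indicator (src e) (𝟙 ∘ X)) (∑-indicator (tgt e) (𝟙 ∘ X)))) ⟩
      𝟙 (S e) * (𝟙 (X (src e)) + 𝟙 (X (tgt e)))
        ≡⟨ endpoints (S e) (X (src e)) (X (tgt e)) ⟩
      2 * 𝟙 (S e ∧ inside X e) + 𝟙 (S e ∧ crosses X e) ∎
      where
      open ≡-Reasoning
      rearrange : ∀ x s a b → x * (s * (a + b)) ≡ s * (a * x + b * x)
      rearrange = solve-∀

  handshake : ∀ (X : Fin n → Bool) (S : Fin m → Bool) →
    ∑[ v < n ] (𝟙 (X v) * ∑[ e < m ] 𝟙 (S e ∧ isIncident v e))
    ≡ 2 * ∑[ e < m ] 𝟙 (S e ∧ inside X e) + ∑[ e < m ] 𝟙 (S e ∧ crosses X e)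
  handshake X S = begin
    ∑[ v < n ] (𝟙 (X v) * ∑[ e < m ] 𝟙 (S e ∧ isIncident v e))
      ≡⟨ ∑-cong (λ v → ∑-*ˡ (𝟙 (X v)) (λ e → 𝟙 (S e ∧ isIncident v e))) ⟩
    ∑[ v < n ] ∑[ e < m ] (𝟙 (X v) * 𝟙 (S e ∧ isIncident v e))
      ≡⟨ ∑-comm (λ v e → 𝟙 (X v) * 𝟙 (S e ∧ isIncident v e)) ⟩
    ∑[ e < m ] ∑[ v < n ] (𝟙 (X v) * 𝟙 (S e ∧ isIncident v e))
      ≡⟨ ∑-cong (at-edge X S) ⟩
    ∑[ e < m ] (2 * 𝟙 (S e ∧ inside X e) + 𝟙 (S e ∧ crosses X e))
      ≡⟨ trans (∑-+ (λ e → 2 * 𝟙 (S e ∧ inside X e)) (λ e → 𝟙 (S e ∧ crosses X e)))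
           (cong (_+ ∑[ e < m ] 𝟙 (S e ∧ crosses X e)) (sym (∑-*ˡ 2 (λ e → 𝟙 (S e ∧ inside X e))))) ⟩
    2 * ∑[ e < m ] 𝟙 (S e ∧ inside X e) + ∑[ e < m ] 𝟙 (S e ∧ crosses X e) ∎
    where open ≡-Reasoning

  crossing-parity : ∀ (X : Fin n → Bool) (S : Fin m → Bool) →
    parity (∑[ v < n ] (𝟙 (X v) * ∑[ e < m ] 𝟙 (S e ∧ isIncident v e)))
    ≡ parity (∑[ e < m ] 𝟙 (S e ∧ crosses X e))
  crossing-parity X S = trans (cong parity (handshake X S))
    (parity-2*+ (∑[ e < m ] 𝟙 (S e ∧ inside X e)) (∑[ e < m ] 𝟙 (S e ∧ crosses X e)))

  matching-parity : ∀ {M} → PerfectMatching G M → ∀ X → parity ∣ X ∣ ≡ parity ∣ M ∩ ∂ G X ∣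
  matching-parity {M} pm X = begin
    parity ∣ X ∣
      ≡⟨ cong parity (∣p∣≡∑ X) ⟩
    parity (∑[ v < n ] 𝟙 (lookup X v))
      ≡⟨ cong parity (∑-cong λ v → sym (trans (cong (𝟙 (lookup X v) *_)
           (trans (sym (∣∩tabulate∣ M (isIncident v))) (pm v))) (*-identityʳ _))) ⟩
    parity (∑[ v < n ] (𝟙 (lookup X v) * ∑[ e < m ] 𝟙 (lookup M e ∧ isIncident v e)))
      ≡⟨ crossing-parity (lookup X) (lookup M) ⟩
    parity (∑[ e < m ] 𝟙 (lookup M e ∧ crosses (lookup X) e))
      ≡⟨ cong parity (sym (∣∩tabulate∣ M (crosses (lookup X)))) ⟩
    parity ∣ M ∩ ∂ G X ∣ ∎
    where open ≡-Reasoning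

  regular-parity : ∀ {r} → Regular G r → ∀ X → parity (r * ∣ X ∣) ≡ parity ∣ ∂ G X ∣
  regular-parity {r} reg X = begin
    parity (r * ∣ X ∣)
      ≡⟨ cong parity (trans (cong (r *_) (∣p∣≡∑ X)) (∑-*ˡ r (𝟙 ∘ lookup X))) ⟩
    parity (∑[ v < n ] (r * 𝟙 (lookup X v)))
      ≡⟨ cong parity (∑-cong λ v → trans (*-comm r _) (cong (𝟙 (lookup X v) *_)
           (trans (sym (reg v)) (∣tabulate∣ (isIncident v))))) ⟩
    parity (∑[ v < n ] (𝟙 (lookup X v) * ∑[ e < m ] 𝟙 (true ∧ isIncident v e)))
      ≡⟨ crossing-parity (lookup X) (λ _ → true) ⟩
    parity (∑[ e < m ] 𝟙 (crosses (lookup X) e))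
      ≡⟨ cong parity (sym (∣tabulate∣ (crosses (lookup X)))) ⟩
    parity ∣ ∂ G X ∣ ∎
    where open ≡-Reasoning

  Reachable-trans : ∀ {a b c} → Reachable G a b → Reachable G b c → Reachable G a c
  Reachable-trans here      q = q
  Reachable-trans (fwd e p) q = fwd e (Reachable-trans p q)
  Reachable-trans (bwd e p) q = bwd e (Reachable-trans p q)

  Reachable-sym : ∀ {a b} → Reachable G a b → Reachable G b a
  Reachable-sym here      = here
  Reachable-sym (fwd e p) = Reachable-trans (Reachable-sym p) (bwd e here)
  Reachable-sym (bwd e p) = Reachable-trans (Reachable-sym p) (fwd e here)

  connected-from : ∀ root → (∀ v → Reachable G root v) → Connected G
  connected-from root reach u v = Reachable-trans (Reachable-sym (reach u)) (reach v)


-- Cycles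

next : ∀ {N} → Fin (suc N) → Fin (suc N)
next {N} i with N ℕ.≟ toℕ i
... | yes _   = zero
... | no  N≢i = suc (lower₁ i N≢i)

prev : ∀ {N} → Fin (suc N) → Fin (suc N)
prev zero    = fromℕ _
prev (suc i) = inject₁ i

next-fromℕ : ∀ N → next (fromℕ N) ≡ zero
next-fromℕ N with N ℕ.≟ toℕ (fromℕ N)
... | yes _   = refl
... | no  N≢N = contradiction (sym (toℕ-fromℕ N)) N≢N

next-inject₁ : ∀ {N} (i : Fin N) → next (inject₁ i) ≡ suc i
next-inject₁ {N} i with N ℕ.≟ toℕ (inject₁ i)
... | yes N≡i = contradiction N≡i (toℕ-inject₁-≢ i)
... | no  N≢i = cong suc (lower₁-inject₁′ i N≢i)

next-prev : ∀ {N} (i : Fin (suc N)) → next (prev i) ≡ i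
next-prev zero    = next-fromℕ _
next-prev (suc i) = next-inject₁ i

prev-next : ∀ {N} (i : Fin (suc N)) → prev (next i) ≡ i
prev-next {N} i with N ℕ.≟ toℕ i
... | yes N≡i = toℕ-injective (trans (toℕ-fromℕ N) N≡i)
... | no  N≢i = inject₁-lower₁ i N≢i

next-≢ : ∀ {N} (i : Fin (suc (suc N))) → next i ≢ i
next-≢ {N} i with suc N ℕ.≟ toℕ i
... | yes N+1≡i = λ 0≡i → 0≢1+n (trans (cong toℕ 0≡i) (sym N+1≡i))
... | no  N+1≢i = λ next≡i → 1+n≢n (trans (cong suc (sym (toℕ-lower₁ i N+1≢i))) (cong toℕ next≡i))

cycle-induction : ∀ {N} (P : Fin (suc N) → Set) → (∀ i → P i → P (next i)) →
                  ∀ {a} → P a → ∀ i → P i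
cycle-induction {N} P step {a} Pa = <-weakInduction P P₀ step′
  where
  step′ : ∀ i → P (inject₁ i) → P (suc i)
  step′ i = subst P (next-inject₁ i) ∘ step (inject₁ i)
  P₀ : P zero
  P₀ = subst P (next-fromℕ N) (step _ (<-weakInduction-startingFrom P Pa step′ (≤fromℕ a)))

cycle-descent : ∀ {N} (y : Fin (suc N) → Bool) {a c} → y a ≡ true → y c ≡ false →
                ∃ λ t → y t ≡ true × y (next t) ≡ false
cycle-descent y {a} {c} ya yc with any? (λ t → (y t B.≟ true) ×-dec (y (next t) B.≟ false))
... | yes descent = descent
... | no ¬descent = contradiction (trans (sym (cycle-induction (λ i → y i ≡ true) stays ya c)) yc) λ ()
  where
  stays : ∀ i → y i ≡ true → y (next i) ≡ true
  stays i yi≡true with y (next i) in eq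
  ... | true  = refl
  ... | false = contradiction (i , yi≡true , eq) ¬descent

private
  crossings-between : ∀ {N} (y : Fin (suc N) → Bool) {a c} → y a ≡ true → y c ≡ false →
                      2 ≤ ∑[ t < suc N ] 𝟙 (y t xor y (next t))
  crossings-between {N} y ya yc
    with cycle-descent y ya yc | cycle-descent (not ∘ y) (cong not yc) (cong not ya)
  ... | t , yt , ynt | u , ¬yu , ¬ynu =
    subst (_≤ ∑[ t < suc N ] 𝟙 (y t xor y (next t))) (cong₂ _+_ (crossing yt ynt) (crossing yu ynu))
      (∑-two-points-≤ (λ t → 𝟙 (y t xor y (next t))) t≢u)
    where
    crossing : ∀ {t} {x x′} → y t ≡ x → y (next t) ≡ x′ → 𝟙 (y t xor y (next t)) ≡ 𝟙 (x xor x′)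
    crossing = cong₂ (λ x x′ → 𝟙 (x xor x′))
    yu : y u ≡ false
    yu = B.not-injective {y u} {false} ¬yu
    ynu : y (next u) ≡ true
    ynu = B.not-injective {y (next u)} {true} ¬ynu
    t≢u : t ≢ u
    t≢u t≡u = contradiction (trans (sym yt) (trans (cong y t≡u) yu)) λ ()

cycle-crossings : ∀ {N} (y : Fin (suc N) → Bool) {a c} → y a ≢ y c →
                  2 ≤ ∑[ t < suc N ] 𝟙 (y t xor y (next t))
cycle-crossings y {a} {c} ya≢yc with y a in ya | y c in yc
... | true  | true  = contradiction refl ya≢yc
... | false | false = contradiction refl ya≢yc
... | true  | false = crossings-between y ya yc
... | false | true  = crossings-between y yc ya


-- The Petersen graph

all-subsets : ∀ {n p} {P : Pred (Subset n) p} → Decidable P → ¬ (∃ λ Y → ¬ P Y) → ∀ Y → P Y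
all-subsets P? none Y = decidable-stable (P? Y) (λ ¬PY → none (Y , ¬PY))

-- Vertices 0–4 form the outer 5-cycle and 5–9 the inner pentagram; together with the ring edges
-- s — ring s they make up a 2-factor, whose complement is the perfect matching of spokes outer i — inner i.
ring : Fin 10 → Fin 10
ring 0F = 1F
ring 1F = 2F
ring 2F = 3F
ring 3F = 4F
ring 4F = 0F
ring 5F = 7F
ring 7F = 9F
ring 9F = 6F
ring 6F = 8F
ring 8F = 5F

outer inner : Fin 5 → Fin 10
outer i = i ↑ˡ 5
inner i = 5 ↑ʳ i

spokeAt : Fin 10 → Fin 5
spokeAt b = [ id , id ]′ (splitAt 5 b)

ringAt : Fin 10 → Fin 10 → Bool
ringAt b s = does (s ≟ b) xor does (ring s ≟ b)

size ringCrossings spokeCrossings outerCount : (Fin 10 → Bool) → ℕ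
size           Y = ∑[ b < 10 ] 𝟙 (Y b)
ringCrossings  Y = ∑[ s < 10 ] 𝟙 (Y s xor Y (ring s))
spokeCrossings Y = ∑[ i < 5 ] 𝟙 (Y (outer i) xor Y (inner i))
outerCount     o = ∑[ i < 5 ] 𝟙 (o (outer i))

ringDegree : (Fin 10 → Bool) → Fin 10 → ℕ
ringDegree o b = ∑[ s < 10 ] 𝟙 (ringAt b s ∧ o s)

ring-preimage : ∀ b → ∑[ s < 10 ] 𝟙 (does (ring s ≟ b)) ≡ 1
ring-preimage = from-yes (all? λ b → ∑[ s < 10 ] 𝟙 (does (ring s ≟ b)) ℕ.≟ 1)

ringAt-count : ∀ b → ∑[ s < 10 ] 𝟙 (ringAt b s) ≡ 2
ringAt-count = from-yes (all? λ b → ∑[ s < 10 ] 𝟙 (ringAt b s) ℕ.≟ 2)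

spokeAt-spec : ∀ b i → (does (outer i ≟ b) xor does (inner i ≟ b)) ≡ does (i ≟ spokeAt b)
spokeAt-spec = from-yes (all? λ b → all? λ i →
  (does (outer i ≟ b) xor does (inner i ≟ b)) B.≟ does (i ≟ spokeAt b))

outer≢inner : ∀ i → outer i ≢ inner i
outer≢inner = from-yes (all? λ i → ¬? (outer i ≟ inner i))

spoke-ends : ∀ b → ∑[ i < 5 ] 𝟙 (does (outer i ≟ b)) + ∑[ i < 5 ] 𝟙 (does (inner i ≟ b)) ≡ 1
spoke-ends b = trans (sym (∑-↑ 5 5 λ x → 𝟙 (does (x ≟ b)))) (∑-point b)

spokeAt-outer : ∀ i → spokeAt (outer i) ≡ i
spokeAt-outer i = cong [ id , id ]′ (splitAt-↑ˡ 5 i 5)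

spokeAt-inner : ∀ i → spokeAt (inner i) ≡ i
spokeAt-inner i = cong [ id , id ]′ (splitAt-↑ʳ 5 5 i)

-- The Petersen graph is a 3-graph, and an odd set crosses the perfect matching of spokes an odd
-- number of times.
OddSetBound : (Fin 10 → Bool) → Set
OddSetBound Y = parity (size Y) ≡ 1ℙ → 1 ≤ spokeCrossings Y × 3 ≤ ringCrossings Y + spokeCrossings Y

oddSetBound? : ∀ Y → Dec (OddSetBound Y)
oddSetBound? Y = (parity (size Y) ℙ.≟ 1ℙ) →-dec
                 ((1 ≤? spokeCrossings Y) ×-dec (3 ≤? ringCrossings Y + spokeCrossings Y))

-- o, completed by the spokes at the vertices of ring degree 0, is a perfect matching of the Petersen
-- graph, and these have 0 or 2 edges on the outer cycle.
MatchingOuterEven : (Fin 10 → Bool) → Set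
MatchingOuterEven o = (∀ i → ringDegree o (outer i) ≡ ringDegree o (inner i)) →
                      (∀ b → ringDegree o b ≤ 1) → parity (outerCount o) ≡ 0ℙ

matchingOuterEven? : ∀ o → Dec (MatchingOuterEven o)
matchingOuterEven? o = all? (λ i → ringDegree o (outer i) ℕ.≟ ringDegree o (inner i)) →-dec
                       (all? (λ b → ringDegree o b ≤? 1) →-dec (parity (outerCount o) ℙ.≟ 0ℙ))

oddSetBound-subsets : ∀ (Y : Subset 10) → OddSetBound (lookup Y)
oddSetBound-subsets = all-subsets (oddSetBound? ∘ lookup) (from-no (anySubset? (¬? ∘ oddSetBound? ∘ lookup)))

matchingOuterEven-subsets : ∀ (o : Subset 10) → MatchingOuterEven (lookup o)
matchingOuterEven-subsets =
  all-subsets (matchingOuterEven? ∘ lookup) (from-no (anySubset? (¬? ∘ matchingOuterEven? ∘ lookup)))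

module _ {Y Y′ : Fin 10 → Bool} (Y≗Y′ : ∀ b → Y b ≡ Y′ b) where
  size-≗ : size Y ≡ size Y′
  size-≗ = ∑-cong (cong 𝟙 ∘ Y≗Y′)

  ringCrossings-≗ : ringCrossings Y ≡ ringCrossings Y′
  ringCrossings-≗ = ∑-cong λ s → cong₂ (λ x y → 𝟙 (x xor y)) (Y≗Y′ s) (Y≗Y′ (ring s))

  spokeCrossings-≗ : spokeCrossings Y ≡ spokeCrossings Y′
  spokeCrossings-≗ = ∑-cong λ i → cong₂ (λ x y → 𝟙 (x xor y)) (Y≗Y′ (outer i)) (Y≗Y′ (inner i))

  outerCount-≗ : outerCount Y ≡ outerCount Y′
  outerCount-≗ = ∑-cong (cong 𝟙 ∘ Y≗Y′ ∘ outer)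

  ringDegree-≗ : ∀ b → ringDegree Y b ≡ ringDegree Y′ b
  ringDegree-≗ b = ∑-cong λ s → cong (λ x → 𝟙 (ringAt b s ∧ x)) (Y≗Y′ s)

petersen-odd-cut : ∀ (Y : Fin 10 → Bool) → OddSetBound Y
petersen-odd-cut Y odd =
  subst₂ (λ a c → 1 ≤ a × 3 ≤ c + a) (spokeCrossings-≗ Y≗) (ringCrossings-≗ Y≗)
    (oddSetBound-subsets (tabulate Y) (trans (cong parity (size-≗ Y≗)) odd))
  where
  Y≗ : ∀ b → lookup (tabulate Y) b ≡ Y b
  Y≗ = lookup∘tabulate Y

petersen-outer-even : ∀ (o : Fin 10 → Bool) (σ : Fin 5 → ℕ) →
  (∀ b → ringDegree o b + σ (spokeAt b) ≡ 1) → parity (outerCount o) ≡ 0ℙ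
petersen-outer-even o σ perfect =
  trans (cong parity (sym (outerCount-≗ o≗))) (matchingOuterEven-subsets (tabulate o) balanced at-most-one)
  where
  o≗ : ∀ s → lookup (tabulate o) s ≡ o s
  o≗ = lookup∘tabulate o
  perfect′ : ∀ b → ringDegree (lookup (tabulate o)) b + σ (spokeAt b) ≡ 1
  perfect′ b = trans (cong (_+ σ (spokeAt b)) (ringDegree-≗ o≗ b)) (perfect b)
  balanced : ∀ i → ringDegree (lookup (tabulate o)) (outer i) ≡ ringDegree (lookup (tabulate o)) (inner i)
  balanced i = +-cancelʳ-≡ (σ i) _ _ (trans
    (subst (λ j → ringDegree (lookup (tabulate o)) (outer i) + σ j ≡ 1) (spokeAt-outer i) (perfect′ (outer i)))
    (sym (subst (λ j → ringDegree (lookup (tabulate o)) (inner i) + σ j ≡ 1) (spokeAt-inner i) (perfect′ (inner i)))))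
  at-most-one : ∀ b → ringDegree (lookup (tabulate o)) b ≤ 1
  at-most-one b = subst (ringDegree (lookup (tabulate o)) b ≤_) (perfect′ b) (m≤m+n _ (σ (spokeAt b)))


-- The construction

module Construction (k′ : ℕ) where

  -- k is the k of the theorem, S = 2k − 1 the number of copies of each spoke and R = 2k + 1 the size of
  -- a blob. Position 0 of blob b carries the ring edge leaving b, position 1 the ring edge entering b,
  -- and position 2 + j the j-th copy of the spoke at b.
  k S R V E : ℕ
  k = suc k′
  S = suc (k′ + k′)
  R = 2 + S
  V = 10 * R
  E = 10 + (5 * S + 10 * (R * k))

  2k≡1+S : 2 * k ≡ suc S
  2k≡1+S = cong suc (trans (cong (k′ +_) (+-identityʳ k)) (+-suc k′ k′))

  R≡2k+1 : R ≡ 2 * k + 1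
  R≡2k+1 = trans (cong suc (sym 2k≡1+S)) (+-comm 1 (2 * k))

  parity-R : parity R ≡ 1ℙ
  parity-R = trans (cong parity R≡2k+1) (parity-2*+ k 1)

  port : Fin S → Fin R
  port j = suc (suc j)

  vertex : Fin 10 → Fin R → Fin V
  vertex = combine

  data Edge : Set where
    ringEdge  : Fin 10 → Edge
    spokeEdge : Fin 5 → Fin S → Edge
    blobEdge  : Fin 10 → Fin R → Fin k → Edge

  srcᴱ tgtᴱ : Edge → Fin V
  srcᴱ (ringEdge s)       = vertex s 0F
  srcᴱ (spokeEdge i j)    = vertex (outer i) (port j)
  srcᴱ (blobEdge b p _)   = vertex b p
  tgtᴱ (ringEdge s)       = vertex (ring s) 1F
  tgtᴱ (spokeEdge i j)    = vertex (inner i) (port j)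
  tgtᴱ (blobEdge b p _)   = vertex b (next p)

  noLoopᴱ : ∀ c → srcᴱ c ≢ tgtᴱ c
  noLoopᴱ (ringEdge s)     eq = contradiction (proj₂ (combine-injective s 0F (ring s) 1F eq)) λ ()
  noLoopᴱ (spokeEdge i j)  eq = outer≢inner i (proj₁ (combine-injective (outer i) (port j) (inner i) (port j) eq))
  noLoopᴱ (blobEdge b p _) eq = next-≢ p (sym (proj₂ (combine-injective b p b (next p) eq)))

  encode : Edge → Fin E
  encode (ringEdge s)     = s ↑ˡ (5 * S + 10 * (R * k))
  encode (spokeEdge i j)  = 10 ↑ʳ (combine i j ↑ˡ 10 * (R * k))
  encode (blobEdge b p q) = 10 ↑ʳ (5 * S ↑ʳ combine b (combine p q))

  blobEdge′ : Fin 10 × Fin (R * k) → Edge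
  blobEdge′ (b , pq) = uncurry (blobEdge b) (remQuot k pq)

  decodeRest : Fin (5 * S + 10 * (R * k)) → Edge
  decodeRest = [ uncurry spokeEdge ∘ remQuot S , blobEdge′ ∘ remQuot (R * k) ]′ ∘ splitAt (5 * S)

  decode : Fin E → Edge
  decode = [ ringEdge , decodeRest ]′ ∘ splitAt 10

  decode-encode : ∀ c → decode (encode c) ≡ c
  decode-encode (ringEdge s) = cong [ ringEdge , decodeRest ]′ (splitAt-↑ˡ 10 s (5 * S + 10 * (R * k)))
  decode-encode (spokeEdge i j) = begin
    decode (encode (spokeEdge i j))
      ≡⟨ cong [ ringEdge , decodeRest ]′ (splitAt-↑ʳ 10 (5 * S + 10 * (R * k)) ij) ⟩
    decodeRest ij
      ≡⟨ cong [ uncurry spokeEdge ∘ remQuot S , blobEdge′ ∘ remQuot (R * k) ]′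
           (splitAt-↑ˡ (5 * S) (combine i j) (10 * (R * k))) ⟩
    uncurry spokeEdge (remQuot S (combine i j))
      ≡⟨ cong (uncurry spokeEdge) (remQuot-combine i j) ⟩
    spokeEdge i j ∎
    where
    open ≡-Reasoning
    ij : Fin (5 * S + 10 * (R * k))
    ij = combine i j ↑ˡ 10 * (R * k)
  decode-encode (blobEdge b p q) = begin
    decode (encode (blobEdge b p q))
      ≡⟨ cong [ ringEdge , decodeRest ]′ (splitAt-↑ʳ 10 (5 * S + 10 * (R * k)) (5 * S ↑ʳ bpq)) ⟩
    decodeRest (5 * S ↑ʳ bpq)
      ≡⟨ cong [ uncurry spokeEdge ∘ remQuot S , blobEdge′ ∘ remQuot (R * k) ]′
           (splitAt-↑ʳ (5 * S) (10 * (R * k)) bpq) ⟩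
    blobEdge′ (remQuot (R * k) bpq)
      ≡⟨ cong blobEdge′ (remQuot-combine b (combine p q)) ⟩
    uncurry (blobEdge b) (remQuot k (combine p q))
      ≡⟨ cong (uncurry (blobEdge b)) (remQuot-combine p q) ⟩
    blobEdge b p q ∎
    where
    open ≡-Reasoning
    bpq : Fin (10 * (R * k))
    bpq = combine b (combine p q)

  G : Graph
  G = record { n = V ; m = E ; src = srcᴱ ∘ decode ; tgt = tgtᴱ ∘ decode ; noLoop = noLoopᴱ ∘ decode }

  ∑ᴱ : (Edge → ℕ) → ℕ
  ∑ᴱ h = ∑[ s < 10 ] h (ringEdge s)
       + (∑[ i < 5 ] ∑[ j < S ] h (spokeEdge i j) + ∑[ b < 10 ] ∑[ p < R ] ∑[ q < k ] h (blobEdge b p q))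

  ∑ᴱ-cong : ∀ {h h′ : Edge → ℕ} → (∀ c → h c ≡ h′ c) → ∑ᴱ h ≡ ∑ᴱ h′
  ∑ᴱ-cong h≗h′ = cong₂ _+_ (∑-cong (h≗h′ ∘ ringEdge)) (cong₂ _+_
    (∑-cong λ i → ∑-cong (h≗h′ ∘ spokeEdge i))
    (∑-cong λ b → ∑-cong λ p → ∑-cong (h≗h′ ∘ blobEdge b p)))

  ∑-encode : ∀ (f : Fin E → ℕ) → sum f ≡ ∑ᴱ (f ∘ encode)
  ∑-encode f = trans (∑-↑ 10 (5 * S + 10 * (R * k)) f) (cong (∑[ s < 10 ] f (encode (ringEdge s)) +_)
    (trans (∑-↑ (5 * S) (10 * (R * k)) (f ∘ (10 ↑ʳ_))) (cong₂ _+_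
      (∑-combine 5 S (λ x → f (10 ↑ʳ (x ↑ˡ 10 * (R * k)))))
      (trans (∑-combine 10 (R * k) (λ y → f (10 ↑ʳ (5 * S ↑ʳ y))))
        (∑-cong {10} λ b → ∑-combine R k (λ z → f (10 ↑ʳ (5 * S ↑ʳ combine b z))))))))

  ∑-edges : ∀ (h : Fin E → Edge → ℕ) → ∑[ e < E ] h e (decode e) ≡ ∑ᴱ (λ c → h (encode c) c)
  ∑-edges h = trans (∑-encode (λ e → h e (decode e))) (∑ᴱ-cong λ c → cong (h (encode c)) (decode-encode c))

  ∀-vertex : ∀ {P : Fin V → Set} → (∀ b p → P (vertex b p)) → ∀ v → P v
  ∀-vertex {P} P-vertex v = subst P (combine-remQuot R v) (uncurry P-vertex (remQuot R v))

  𝟙-vertex-≟ : ∀ a c b p → 𝟙 (does (vertex a c ≟ vertex b p)) ≡ 𝟙 (does (a ≟ b)) * 𝟙 (does (c ≟ p))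
  𝟙-vertex-≟ a c b p = trans (cong 𝟙 (does-⇔
      (mk⇔ (combine-injective a c b p) (λ (a≡b , c≡p) → cong₂ vertex a≡b c≡p))
      (vertex a c ≟ vertex b p) ((a ≟ b) ×-dec (c ≟ p))))
    (𝟙-∧ (does (a ≟ b)) (does (c ≟ p)))

  incidences : Fin V → Edge → ℕ
  incidences v c = 𝟙 (does (srcᴱ c ≟ v)) + 𝟙 (does (tgtᴱ c ≟ v))

  ring-incidences : ∀ b p →
    ∑[ s < 10 ] incidences (vertex b p) (ringEdge s) ≡ 𝟙 (does (0F ≟ p)) + 𝟙 (does (1F ≟ p))
  ring-incidences b p = begin
    ∑[ s < 10 ] incidences (vertex b p) (ringEdge s)
      ≡⟨ ∑-cong (λ s → cong₂ _+_ (𝟙-vertex-≟ s 0F b p) (𝟙-vertex-≟ (ring s) 1F b p)) ⟩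
    ∑[ s < 10 ] (𝟙 (does (s ≟ b)) * p₀ + 𝟙 (does (ring s ≟ b)) * p₁)
      ≡⟨ ∑-+ (λ s → 𝟙 (does (s ≟ b)) * p₀) (λ s → 𝟙 (does (ring s ≟ b)) * p₁) ⟩
    ∑[ s < 10 ] (𝟙 (does (s ≟ b)) * p₀) + ∑[ s < 10 ] (𝟙 (does (ring s ≟ b)) * p₁)
      ≡⟨ cong₂ _+_ (trans (∑-*ʳ (λ s → 𝟙 (does (s ≟ b))) p₀) (cong (_* p₀) (∑-point b)))
                   (trans (∑-*ʳ (λ s → 𝟙 (does (ring s ≟ b))) p₁) (cong (_* p₁) (ring-preimage b))) ⟩
    1 * p₀ + 1 * p₁
      ≡⟨ cong₂ _+_ (*-identityˡ p₀) (*-identityˡ p₁) ⟩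
    p₀ + p₁ ∎
    where
    open ≡-Reasoning
    p₀ p₁ : ℕ
    p₀ = 𝟙 (does (0F ≟ p))
    p₁ = 𝟙 (does (1F ≟ p))

  spoke-incidences : ∀ b p →
    ∑[ i < 5 ] ∑[ j < S ] incidences (vertex b p) (spokeEdge i j) ≡ ∑[ j < S ] 𝟙 (does (port j ≟ p))
  spoke-incidences b p = begin
    ∑[ i < 5 ] ∑[ j < S ] incidences (vertex b p) (spokeEdge i j)
      ≡⟨ ∑-cong (λ i → ∑-cong λ j → trans
           (cong₂ _+_ (𝟙-vertex-≟ (outer i) (port j) b p) (𝟙-vertex-≟ (inner i) (port j) b p))
           (sym (*-distribʳ-+ (𝟙 (does (port j ≟ p))) (atOuter i) (atInner i)))) ⟩
    ∑[ i < 5 ] ∑[ j < S ] ((atOuter i + atInner i) * 𝟙 (does (port j ≟ p)))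
      ≡⟨ ∑-product (λ i → atOuter i + atInner i) (λ j → 𝟙 (does (port j ≟ p))) ⟩
    ∑[ i < 5 ] (atOuter i + atInner i) * ∑[ j < S ] 𝟙 (does (port j ≟ p))
      ≡⟨ cong (_* ∑[ j < S ] 𝟙 (does (port j ≟ p))) (trans (∑-+ atOuter atInner) (spoke-ends b)) ⟩
    1 * ∑[ j < S ] 𝟙 (does (port j ≟ p))
      ≡⟨ *-identityˡ _ ⟩
    ∑[ j < S ] 𝟙 (does (port j ≟ p)) ∎
    where
    open ≡-Reasoning
    atOuter atInner : Fin 5 → ℕ
    atOuter i = 𝟙 (does (outer i ≟ b))
    atInner i = 𝟙 (does (inner i ≟ b))

  external-incidences : ∀ b p →
    ∑[ s < 10 ] incidences (vertex b p) (ringEdge s)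
    + ∑[ i < 5 ] ∑[ j < S ] incidences (vertex b p) (spokeEdge i j) ≡ 1
  external-incidences b p =
    trans (cong₂ _+_ (ring-incidences b p) (spoke-incidences b p))
      (trans (+-assoc (𝟙 (does (0F ≟ p))) (𝟙 (does (1F ≟ p))) (∑[ j < S ] 𝟙 (does (port j ≟ p)))) (∑-point p))

  blob-incidences : ∀ b p →
    ∑[ b′ < 10 ] ∑[ p′ < R ] ∑[ q < k ] incidences (vertex b p) (blobEdge b′ p′ q) ≡ k * 2
  blob-incidences b p = begin
    ∑[ b′ < 10 ] ∑[ p′ < R ] ∑[ q < k ] incidences (vertex b p) (blobEdge b′ p′ q)
      ≡⟨ ∑-cong (λ b′ → ∑-cong λ p′ → trans (∑-const k _) (trans
           (cong (k *_) (trans (cong₂ _+_ (𝟙-vertex-≟ b′ p′ b p) (𝟙-vertex-≟ b′ (next p′) b p))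
             (sym (*-distribˡ-+ (𝟙 (does (b′ ≟ b))) _ _))))
           (reorder k (𝟙 (does (b′ ≟ b))) (onCycle p′)))) ⟩
    ∑[ b′ < 10 ] ∑[ p′ < R ] (𝟙 (does (b′ ≟ b)) * (k * onCycle p′))
      ≡⟨ ∑-product (λ b′ → 𝟙 (does (b′ ≟ b))) (λ p′ → k * onCycle p′) ⟩
    ∑[ b′ < 10 ] 𝟙 (does (b′ ≟ b)) * ∑[ p′ < R ] (k * onCycle p′)
      ≡⟨ cong₂ _*_ (∑-point b) (sym (∑-*ˡ k onCycle)) ⟩
    1 * (k * ∑[ p′ < R ] onCycle p′)
      ≡⟨ *-identityˡ _ ⟩
    k * ∑[ p′ < R ] onCycle p′
      ≡⟨ cong (k *_) (trans (∑-+ (λ p′ → 𝟙 (does (p′ ≟ p))) (λ p′ → 𝟙 (does (next p′ ≟ p))))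
           (cong₂ _+_ (∑-point p) (∑-preimage next prev next-prev prev-next p))) ⟩
    k * 2 ∎
    where
    open ≡-Reasoning
    onCycle : Fin R → ℕ
    onCycle p′ = 𝟙 (does (p′ ≟ p)) + 𝟙 (does (next p′ ≟ p))
    reorder : ∀ x y z → x * (y * z) ≡ y * (x * z)
    reorder = solve-∀

  incidence-count : ∀ (w : Edge → Bool) v →
    ∑[ e < E ] 𝟙 (w (decode e) ∧ isIncident G v e) ≡ ∑ᴱ (λ c → 𝟙 (w c) * incidences v c)
  incidence-count w v = trans (∑-cong λ e → 𝟙-isIncident G (w (decode e)) e v)
                              (∑-edges λ _ c → 𝟙 (w c) * incidences v c)

  degree-vertex : ∀ b p → degree G (vertex b p) ≡ 2 * k + 1
  degree-vertex b p = begin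
    degree G v
      ≡⟨ ∣tabulate∣ (isIncident G v) ⟩
    ∑[ e < E ] 𝟙 (true ∧ isIncident G v e)
      ≡⟨ incidence-count (λ _ → true) v ⟩
    ∑ᴱ (λ c → 1 * incidences v c)
      ≡⟨ trans (∑ᴱ-cong (λ c → *-identityˡ (incidences v c))) (sym (+-assoc ring∑ spoke∑ blob∑)) ⟩
    ring∑ + spoke∑ + blob∑
      ≡⟨ cong₂ _+_ (external-incidences b p) (blob-incidences b p) ⟩
    1 + k * 2
      ≡⟨ trans (+-comm 1 (k * 2)) (cong (_+ 1) (*-comm k 2)) ⟩
    2 * k + 1 ∎
    where
    open ≡-Reasoning
    v : Fin V
    v = vertex b p
    ring∑ spoke∑ blob∑ : ℕ
    ring∑ = ∑[ s < 10 ] incidences v (ringEdge s)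
    spoke∑ = ∑[ i < 5 ] ∑[ j < S ] incidences v (spokeEdge i j)
    blob∑ = ∑[ b′ < 10 ] ∑[ p′ < R ] ∑[ q < k ] incidences v (blobEdge b′ p′ q)

  regular : Regular G (2 * k + 1)
  regular = ∀-vertex degree-vertex

  external : Edge → Bool
  external (ringEdge _)      = true
  external (spokeEdge _ _)   = true
  external (blobEdge _ _ _)  = false

  F : Subset E
  F = tabulate (external ∘ decode)

  F-at-vertex : ∀ b p → ∣ F ∩ incident G (vertex b p) ∣ ≡ 1
  F-at-vertex b p = begin
    ∣ F ∩ incident G v ∣
      ≡⟨ ∣∩tabulate∣ F (isIncident G v) ⟩
    ∑[ e < E ] 𝟙 (lookup F e ∧ isIncident G v e)
      ≡⟨ ∑-cong (λ e → cong (λ x → 𝟙 (x ∧ isIncident G v e)) (lookup∘tabulate (external ∘ decode) e)) ⟩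
    ∑[ e < E ] 𝟙 (external (decode e) ∧ isIncident G v e)
      ≡⟨ incidence-count external v ⟩
    ∑ᴱ (λ c → 𝟙 (external c) * incidences v c)
      ≡⟨ cong₂ _+_ (∑-cong {10} λ s → *-identityˡ (incidences v (ringEdge s)))
           (cong₂ _+_ (∑-cong {5} λ i → ∑-cong {S} λ j → *-identityˡ (incidences v (spokeEdge i j)))
             (trans (∑-cong {10} λ b′ → trans (∑-cong {R} λ p′ → ∑-zero k) (∑-zero R)) (∑-zero 10))) ⟩
    ∑[ s < 10 ] incidences v (ringEdge s) + (∑[ i < 5 ] ∑[ j < S ] incidences v (spokeEdge i j) + 0)
      ≡⟨ trans (cong (∑[ s < 10 ] incidences v (ringEdge s) +_) (+-identityʳ _)) (external-incidences b p) ⟩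
    1 ∎
    where
    open ≡-Reasoning
    v : Fin V
    v = vertex b p

  F-perfect : PerfectMatching G F
  F-perfect = ∀-vertex F-at-vertex

  edge-reachable : ∀ c → Reachable G (srcᴱ c) (tgtᴱ c)
  edge-reachable c =
    subst₂ (Reachable G) (cong srcᴱ (decode-encode c)) (cong tgtᴱ (decode-encode c)) (fwd (encode c) here)

  root : Fin V
  root = vertex 0F 0F

  BlobReached : Fin 10 → Set
  BlobReached b = ∀ p → Reachable G root (vertex b p)

  spread : ∀ b p → Reachable G root (vertex b p) → BlobReached b
  spread b p = cycle-induction (λ p → Reachable G root (vertex b p))
                               (λ p r → Reachable-trans G r (edge-reachable (blobEdge b p 0F)))

  via-ring : ∀ s → BlobReached s → BlobReached (ring s)
  via-ring s reached = spread (ring s) 1F (Reachable-trans G (reached 0F) (edge-reachable (ringEdge s)))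

  via-spoke : ∀ i → BlobReached (outer i) → BlobReached (inner i)
  via-spoke i reached = spread (inner i) (port 0F) (Reachable-trans G (reached (port 0F)) (edge-reachable (spokeEdge i 0F)))

  root-blob-reached : BlobReached 0F
  root-blob-reached = spread 0F 0F here

  outer-reached : ∀ i → BlobReached (outer i)
  outer-reached 0F = root-blob-reached
  outer-reached 1F = via-ring 0F root-blob-reached
  outer-reached 2F = via-ring 1F (via-ring 0F root-blob-reached)
  outer-reached 3F = via-ring 2F (via-ring 1F (via-ring 0F root-blob-reached))
  outer-reached 4F = via-ring 3F (via-ring 2F (via-ring 1F (via-ring 0F root-blob-reached)))

  all-blobs-reached : ∀ b → BlobReached b
  all-blobs-reached 0F = outer-reached 0F
  all-blobs-reached 1F = outer-reached 1F
  all-blobs-reached 2F = outer-reached 2F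
  all-blobs-reached 3F = outer-reached 3F
  all-blobs-reached 4F = outer-reached 4F
  all-blobs-reached 5F = via-spoke 0F (outer-reached 0F)
  all-blobs-reached 6F = via-spoke 1F (outer-reached 1F)
  all-blobs-reached 7F = via-spoke 2F (outer-reached 2F)
  all-blobs-reached 8F = via-spoke 3F (outer-reached 3F)
  all-blobs-reached 9F = via-spoke 4F (outer-reached 4F)

  connected : Connected G
  connected = connected-from G root (∀-vertex all-blobs-reached)

  module _ (X : Subset V) where
    private
      x : Fin 10 → Fin R → Bool
      x b p = lookup X (vertex b p)

    cut : Edge → ℕ
    cut c = 𝟙 (lookup X (srcᴱ c) xor lookup X (tgtᴱ c))

    ∣∂∣≡∑ᴱ-cut : ∣ ∂ G X ∣ ≡ ∑ᴱ cut
    ∣∂∣≡∑ᴱ-cut = trans (∣tabulate∣ (crosses G (lookup X))) (∑-edges λ _ → cut)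

    blob-cut-≤ : ∀ b → ∑[ p < R ] ∑[ q < k ] cut (blobEdge b p q) ≤ ∑ᴱ cut
    blob-cut-≤ b = begin
      ∑[ p < R ] ∑[ q < k ] cut (blobEdge b p q)
        ≤⟨ ∑-point-≤ (λ b′ → ∑[ p < R ] ∑[ q < k ] cut (blobEdge b′ p q)) b ⟩
      blob∑
        ≤⟨ m≤n+m blob∑ spoke∑ ⟩
      spoke∑ + blob∑
        ≤⟨ m≤n+m (spoke∑ + blob∑) (∑[ s < 10 ] cut (ringEdge s)) ⟩
      ∑ᴱ cut ∎
      where
      open ≤-Reasoning
      spoke∑ blob∑ : ℕ
      spoke∑ = ∑[ i < 5 ] ∑[ j < S ] cut (spokeEdge i j)
      blob∑ = ∑[ b′ < 10 ] ∑[ p < R ] ∑[ q < k ] cut (blobEdge b′ p q)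

    split-blob-cut : ∀ b {p p′} → x b p ≢ x b p′ → 2 * k ≤ ∑ᴱ cut
    split-blob-cut b x≢ = begin
      2 * k
        ≡⟨ *-comm 2 k ⟩
      k * 2
        ≤⟨ *-monoʳ-≤ k (cycle-crossings (x b) x≢) ⟩
      k * ∑[ p < R ] 𝟙 (x b p xor x b (next p))
        ≡⟨ ∑-*ˡ k (λ p → 𝟙 (x b p xor x b (next p))) ⟩
      ∑[ p < R ] (k * 𝟙 (x b p xor x b (next p)))
        ≡⟨ ∑-cong (λ p → sym (∑-const k (𝟙 (x b p xor x b (next p))))) ⟩
      ∑[ p < R ] ∑[ q < k ] cut (blobEdge b p q)
        ≤⟨ blob-cut-≤ b ⟩
      ∑ᴱ cut ∎
      where open ≤-Reasoning

    module _ (uniform : ∀ b p → x b p ≡ x b 0F) where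
      private
        Y : Fin 10 → Bool
        Y b = x b 0F

      ∣X∣≡R*size : ∣ X ∣ ≡ R * size Y
      ∣X∣≡R*size = begin
        ∣ X ∣                                 ≡⟨ ∣p∣≡∑ X ⟩
        ∑[ v < V ] 𝟙 (lookup X v)             ≡⟨ ∑-combine 10 R (𝟙 ∘ lookup X) ⟩
        ∑[ b < 10 ] ∑[ p < R ] 𝟙 (x b p)      ≡⟨ ∑-cong (λ b → trans (∑-cong λ p → cong 𝟙 (uniform b p)) (∑-const R (𝟙 (Y b)))) ⟩
        ∑[ b < 10 ] (R * 𝟙 (Y b))             ≡⟨ sym (∑-*ˡ R (𝟙 ∘ Y)) ⟩
        R * size Y                            ∎
        where open ≡-Reasoning

      uniform-cut : parity ∣ X ∣ ≡ 1ℙ → R ≤ ∑ᴱ cut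
      uniform-cut odd = begin
        3 + k′ + k′
          ≤⟨ weighted-sum-≥ {ringCrossings Y} (k′ + k′) spoke≥1 ≥3 ⟩
        ringCrossings Y + S * spokeCrossings Y
          ≡⟨ cong₂ _+_ (sym ring-cut) (sym spoke-cut) ⟩
        ∑[ s < 10 ] cut (ringEdge s) + ∑[ i < 5 ] ∑[ j < S ] cut (spokeEdge i j)
          ≤⟨ +-monoʳ-≤ (∑[ s < 10 ] cut (ringEdge s))
               (m≤m+n (∑[ i < 5 ] ∑[ j < S ] cut (spokeEdge i j)) (∑[ b < 10 ] ∑[ p < R ] ∑[ q < k ] cut (blobEdge b p q))) ⟩
        ∑ᴱ cut ∎
        where
        open ≤-Reasoning
        Y-odd : parity (size Y) ≡ 1ℙ
        Y-odd = trans (sym (cong (_*ℙ parity (size Y)) parity-R))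
                  (trans (sym (*-homo-* R (size Y))) (trans (cong parity (sym ∣X∣≡R*size)) odd))
        spoke≥1 : 1 ≤ spokeCrossings Y
        spoke≥1 = proj₁ (petersen-odd-cut Y Y-odd)
        ≥3 : 3 ≤ ringCrossings Y + spokeCrossings Y
        ≥3 = proj₂ (petersen-odd-cut Y Y-odd)
        ring-cut : ∑[ s < 10 ] cut (ringEdge s) ≡ ringCrossings Y
        ring-cut = ∑-cong λ s → cong (λ y → 𝟙 (Y s xor y)) (uniform (ring s) 1F)
        spoke-cut : ∑[ i < 5 ] ∑[ j < S ] cut (spokeEdge i j) ≡ S * spokeCrossings Y
        spoke-cut = trans (∑-cong λ i → trans (∑-cong λ j →
            cong₂ (λ y y′ → 𝟙 (y xor y′)) (uniform (outer i) (port j)) (uniform (inner i) (port j)))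
          (∑-const S _)) (sym (∑-*ˡ S λ i → 𝟙 (Y (outer i) xor Y (inner i))))

    odd-cut : Odd G X → 2 * k + 1 ≤ ∣ ∂ G X ∣
    odd-cut odd = odd-above-even k ∂-odd (subst (2 * k ≤_) (sym ∣∂∣≡∑ᴱ-cut) cut-bound)
      where
      X-odd : parity ∣ X ∣ ≡ 1ℙ
      X-odd = %2≡1⇒parity≡1ℙ ∣ X ∣ odd
      ∂-odd : parity ∣ ∂ G X ∣ ≡ 1ℙ
      ∂-odd = trans (sym (regular-parity G regular X))
                (trans (*-homo-* (2 * k + 1) ∣ X ∣) (cong₂ _*ℙ_ (parity-2*+ k 1) X-odd))
      cut-bound : 2 * k ≤ ∑ᴱ cut
      cut-bound with any? (λ b → any? λ p → ¬? (x b p B.≟ x b 0F))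
      ... | yes (b , p , x≢) = split-blob-cut b x≢
      ... | no ¬split = ≤-trans (subst (_≤ R) (sym 2k≡1+S) (n≤1+n _))
          (uniform-cut (λ b p → decidable-stable (x b p B.≟ x b 0F) λ x≢ → ¬split (b , p , x≢)) X-odd)

  blobSet : Fin 10 → Subset V
  blobSet b = tabulate (λ v → does (quotient R v ≟ b))

  blobSet-vertex : ∀ b b′ p → lookup (blobSet b) (vertex b′ p) ≡ does (b′ ≟ b)
  blobSet-vertex b b′ p = trans (lookup∘tabulate (λ v → does (quotient R v ≟ b)) (vertex b′ p))
                                (cong (λ bp → does (proj₁ bp ≟ b)) (remQuot-combine b′ p))

  ∣blobSet∣ : ∀ b → ∣ blobSet b ∣ ≡ R
  ∣blobSet∣ b = begin
    ∣ blobSet b ∣                                         ≡⟨ ∣p∣≡∑ (blobSet b) ⟩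
    ∑[ v < V ] 𝟙 (lookup (blobSet b) v)                   ≡⟨ ∑-combine 10 R (𝟙 ∘ lookup (blobSet b)) ⟩
    ∑[ b′ < 10 ] ∑[ p < R ] 𝟙 (lookup (blobSet b) (vertex b′ p))
      ≡⟨ ∑-cong (λ b′ → trans (∑-cong λ p → cong 𝟙 (blobSet-vertex b b′ p)) (∑-const R (𝟙 (does (b′ ≟ b))))) ⟩
    ∑[ b′ < 10 ] (R * 𝟙 (does (b′ ≟ b)))                  ≡⟨ sym (∑-*ˡ R λ b′ → 𝟙 (does (b′ ≟ b))) ⟩
    R * ∑[ b′ < 10 ] 𝟙 (does (b′ ≟ b))                    ≡⟨ trans (cong (R *_) (∑-point b)) (*-identityʳ R) ⟩
    R                                                     ∎
    where open ≡-Reasoning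

  spokeLoad : (Edge → Bool) → Fin 5 → ℕ
  spokeLoad u i = ∑[ j < S ] 𝟙 (u (spokeEdge i j))

  boundary : (Edge → Bool) → Fin 10 → ℕ
  boundary u b = ringDegree (u ∘ ringEdge) b + spokeLoad u (spokeAt b)

  boundary-∂ : ∀ (M : Subset E) b → ∣ M ∩ ∂ G (blobSet b) ∣ ≡ boundary (lookup M ∘ encode) b
  boundary-∂ M b = begin
    ∣ M ∩ ∂ G (blobSet b) ∣
      ≡⟨ ∣∩tabulate∣ M (crosses G (lookup (blobSet b))) ⟩
    ∑[ e < E ] 𝟙 (lookup M e ∧ crosses G (lookup (blobSet b)) e)
      ≡⟨ ∑-edges (λ e c → 𝟙 (lookup M e ∧ crossesᴱ c)) ⟩
    ∑ᴱ (λ c → 𝟙 (u c ∧ crossesᴱ c))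
      ≡⟨ cong₂ _+_ ring-part (cong₂ _+_ spoke-part blob-part) ⟩
    ringDegree (u ∘ ringEdge) b + (spokeLoad u (spokeAt b) + 0)
      ≡⟨ cong (ringDegree (u ∘ ringEdge) b +_) (+-identityʳ (spokeLoad u (spokeAt b))) ⟩
    boundary u b ∎
    where
    open ≡-Reasoning
    u : Edge → Bool
    u = lookup M ∘ encode
    crossesᴱ : Edge → Bool
    crossesᴱ c = lookup (blobSet b) (srcᴱ c) xor lookup (blobSet b) (tgtᴱ c)
    ring-part : ∑[ s < 10 ] 𝟙 (u (ringEdge s) ∧ crossesᴱ (ringEdge s)) ≡ ringDegree (u ∘ ringEdge) b
    ring-part = ∑-cong λ s → cong 𝟙 (trans
      (cong₂ (λ y y′ → u (ringEdge s) ∧ (y xor y′)) (blobSet-vertex b s 0F) (blobSet-vertex b (ring s) 1F))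
      (B.∧-comm (u (ringEdge s)) (ringAt b s)))
    spoke-part : ∑[ i < 5 ] ∑[ j < S ] 𝟙 (u (spokeEdge i j) ∧ crossesᴱ (spokeEdge i j)) ≡ spokeLoad u (spokeAt b)
    spoke-part = trans (∑-cong λ i → trans (∑-cong λ j → trans (cong 𝟙 (trans
        (cong₂ (λ y y′ → u (spokeEdge i j) ∧ (y xor y′))
          (blobSet-vertex b (outer i) (port j)) (blobSet-vertex b (inner i) (port j)))
        (trans (cong (u (spokeEdge i j) ∧_) (spokeAt-spec b i)) (B.∧-comm (u (spokeEdge i j)) _))))
        (𝟙-∧ (does (i ≟ spokeAt b)) (u (spokeEdge i j))))
      (sym (∑-*ˡ (𝟙 (does (i ≟ spokeAt b))) λ j → 𝟙 (u (spokeEdge i j)))))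
      (∑-indicator′ (spokeAt b) (spokeLoad u))
    blob-part : ∑[ b′ < 10 ] ∑[ p < R ] ∑[ q < k ] 𝟙 (u (blobEdge b′ p q) ∧ crossesᴱ (blobEdge b′ p q)) ≡ 0
    blob-part = trans (∑-cong λ b′ → trans (∑-cong λ p → trans (∑-cong λ q → cong 𝟙 (trans
        (cong₂ (λ y y′ → u (blobEdge b′ p q) ∧ (y xor y′)) (blobSet-vertex b b′ p) (blobSet-vertex b b′ (next p)))
        (trans (cong (u (blobEdge b′ p q) ∧_) (B.xor-same (does (b′ ≟ b)))) (B.∧-zeroʳ (u (blobEdge b′ p q))))))
      (∑-zero k)) (∑-zero R)) (∑-zero 10)

  boundary-odd : ∀ {M} → PerfectMatching G M → ∀ b → parity (boundary (lookup M ∘ encode) b) ≡ 1ℙ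
  boundary-odd {M} pm b = begin
    parity (boundary (lookup M ∘ encode) b)  ≡⟨ cong parity (sym (boundary-∂ M b)) ⟩
    parity ∣ M ∩ ∂ G (blobSet b) ∣           ≡⟨ sym (matching-parity G {M} pm (blobSet b)) ⟩
    parity ∣ blobSet b ∣                     ≡⟨ cong parity (∣blobSet∣ b) ⟩
    parity R                                 ≡⟨ parity-R ⟩
    1ℙ                                       ∎
    where open ≡-Reasoning

  boundary-partition : ∀ {n} (u : Edge → Bool) (us : Fin n → Edge → Bool) →
    (∀ c → external c ≡ true → 𝟙 (u c) + ∑[ i < n ] 𝟙 (us i c) ≡ 1) →
    ∀ b → boundary u b + ∑[ i < n ] boundary (us i) b ≡ R
  boundary-partition {n} u us split b = begin
    boundary u b + ∑[ i < n ] boundary (us i) b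
      ≡⟨ cong (boundary u b +_) (∑-+ (λ i → ringDegree (us i ∘ ringEdge) b) (λ i → spokeLoad (us i) (spokeAt b))) ⟩
    (ringDegree (u ∘ ringEdge) b + spokeLoad u (spokeAt b))
      + (∑[ i < n ] ringDegree (us i ∘ ringEdge) b + ∑[ i < n ] spokeLoad (us i) (spokeAt b))
      ≡⟨ +-interchange (ringDegree (u ∘ ringEdge) b) (spokeLoad u (spokeAt b))
           (∑[ i < n ] ringDegree (us i ∘ ringEdge) b) (∑[ i < n ] spokeLoad (us i) (spokeAt b)) ⟩
    (ringDegree (u ∘ ringEdge) b + ∑[ i < n ] ringDegree (us i ∘ ringEdge) b)
      + (spokeLoad u (spokeAt b) + ∑[ i < n ] spokeLoad (us i) (spokeAt b))
      ≡⟨ cong₂ _+_ ring-part spoke-part ⟩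
    2 + S * 1
      ≡⟨ cong (2 +_) (*-identityʳ S) ⟩
    R ∎
    where
    open ≡-Reasoning
    ring-part : ringDegree (u ∘ ringEdge) b + ∑[ i < n ] ringDegree (us i ∘ ringEdge) b ≡ 2
    ring-part = begin
      ringDegree (u ∘ ringEdge) b + ∑[ i < n ] ringDegree (us i ∘ ringEdge) b
        ≡⟨ cong (ringDegree (u ∘ ringEdge) b +_) (∑-comm (λ i s → 𝟙 (ringAt b s ∧ us i (ringEdge s)))) ⟩
      ringDegree (u ∘ ringEdge) b + ∑[ s < 10 ] ∑[ i < n ] 𝟙 (ringAt b s ∧ us i (ringEdge s))
        ≡⟨ sym (∑-+ (λ s → 𝟙 (ringAt b s ∧ u (ringEdge s))) (λ s → ∑[ i < n ] 𝟙 (ringAt b s ∧ us i (ringEdge s)))) ⟩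
      ∑[ s < 10 ] (𝟙 (ringAt b s ∧ u (ringEdge s)) + ∑[ i < n ] 𝟙 (ringAt b s ∧ us i (ringEdge s)))
        ≡⟨ ∑-cong (λ s → 𝟙-∧-split (ringAt b s) (u (ringEdge s)) (λ i → us i (ringEdge s)) (split (ringEdge s) refl)) ⟩
      ∑[ s < 10 ] 𝟙 (ringAt b s)
        ≡⟨ ringAt-count b ⟩
      2 ∎
    spoke-part : spokeLoad u (spokeAt b) + ∑[ i < n ] spokeLoad (us i) (spokeAt b) ≡ S * 1
    spoke-part = begin
      spokeLoad u (spokeAt b) + ∑[ i < n ] spokeLoad (us i) (spokeAt b)
        ≡⟨ cong (spokeLoad u (spokeAt b) +_) (∑-comm (λ i j → 𝟙 (us i (spokeEdge (spokeAt b) j)))) ⟩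
      spokeLoad u (spokeAt b) + ∑[ j < S ] ∑[ i < n ] 𝟙 (us i (spokeEdge (spokeAt b) j))
        ≡⟨ sym (∑-+ (λ j → 𝟙 (u (spokeEdge (spokeAt b) j))) (λ j → ∑[ i < n ] 𝟙 (us i (spokeEdge (spokeAt b) j)))) ⟩
      ∑[ j < S ] (𝟙 (u (spokeEdge (spokeAt b) j)) + ∑[ i < n ] 𝟙 (us i (spokeEdge (spokeAt b) j)))
        ≡⟨ trans (∑-cong λ j → split (spokeEdge (spokeAt b) j) refl) (∑-const S 1) ⟩
      S * 1 ∎

  F-encode : ∀ c → lookup F (encode c) ≡ external c
  F-encode c = trans (lookup∘tabulate (external ∘ decode) (encode c)) (cong external (decode-encode c))

  module _ (Fs : Fin (2 * k) → Subset E) (Fs-perfect : ∀ i → PerfectMatching G (Fs i))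
           (exclusive : ∀ c → external c ≡ true → ∀ {i j} →
                        lookup (Fs i) (encode c) ≡ true → lookup (Fs j) (encode c) ≡ true → i ≡ j) where
    private
      us : Fin (2 * k) → Edge → Bool
      us i = lookup (Fs i) ∘ encode

      unused : Edge → Bool
      unused c = ∑[ i < 2 * k ] 𝟙 (us i c) ℕ.≡ᵇ 0

      split : ∀ c → external c ≡ true → 𝟙 (unused c) + ∑[ i < 2 * k ] 𝟙 (us i c) ≡ 1
      split c ext = 𝟙[≡ᵇ0]+≡1 (∑-exclusive-≤1 (λ i → us i c) (exclusive c ext))

      tight : ∀ b → boundary unused b ≡ 1 × (∀ i → boundary (us i) b ≡ 1)
      tight b = odd-parts-tight (boundary unused b) (λ i → boundary (us i) b) (λ i → boundary-odd {Fs i} (Fs-perfect i) b)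
                  (trans (boundary-partition unused us split b) (cong suc (sym 2k≡1+S)))

      outer-even : ∀ u → (∀ b → boundary u b ≡ 1) → parity (outerCount (u ∘ ringEdge)) ≡ 0ℙ
      outer-even u perfect = petersen-outer-even (u ∘ ringEdge) (spokeLoad u) perfect

    exclusive-matchings-impossible : ⊥
    exclusive-matchings-impossible = contradiction (begin
      1ℙ
        ≡⟨⟩
      parity (∑[ o < 5 ] 1)
        ≡⟨ cong parity (sym (∑-cong λ o → split (ringEdge (outer o)) refl)) ⟩
      parity (∑[ o < 5 ] (𝟙 (unused (ringEdge (outer o))) + ∑[ i < 2 * k ] 𝟙 (us i (ringEdge (outer o)))))
        ≡⟨ cong parity (trans (∑-+ (λ o → 𝟙 (unused (ringEdge (outer o)))) (λ o → ∑[ i < 2 * k ] 𝟙 (us i (ringEdge (outer o)))))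
             (cong (outerCount (unused ∘ ringEdge) +_) (∑-comm (λ o i → 𝟙 (us i (ringEdge (outer o))))))) ⟩
      parity (outerCount (unused ∘ ringEdge) + ∑[ i < 2 * k ] outerCount (us i ∘ ringEdge))
        ≡⟨ +-homo-+ (outerCount (unused ∘ ringEdge)) (∑[ i < 2 * k ] outerCount (us i ∘ ringEdge)) ⟩
      parity (outerCount (unused ∘ ringEdge)) +ℙ parity (∑[ i < 2 * k ] outerCount (us i ∘ ringEdge))
        ≡⟨ cong₂ _+ℙ_ (outer-even unused (proj₁ ∘ tight))
             (parity-∑-even (λ i → outerCount (us i ∘ ringEdge)) λ i → outer-even (us i) λ b → proj₂ (tight b) i) ⟩
      0ℙ ∎) λ ()
      where open ≡-Reasoning

  F-shared : ∀ (Fs : Fin (2 * k) → Subset E) → (∀ i → PerfectMatching G (Fs i)) →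
             ∃ λ i → ∃ λ j → i < j × Nonempty (F ∩ Fs i ∩ Fs j)
  F-shared Fs Fs-perfect =
    decidable-stable (any? λ i → any? λ j → (i Fin.<? j) ×-dec nonempty? (F ∩ Fs i ∩ Fs j)) λ ¬shared →
      exclusive-matchings-impossible Fs Fs-perfect (exclusive ¬shared)
    where
    ∈F∩∩ : ∀ c {i j} → external c ≡ true → lookup (Fs i) (encode c) ≡ true → lookup (Fs j) (encode c) ≡ true →
           encode c ∈ F ∩ Fs i ∩ Fs j
    ∈F∩∩ c {i} {j} ext ∈Fsi ∈Fsj = x∈p∩q⁺ (lookup⇒[]= (encode c) F (trans (F-encode c) ext) ,
      x∈p∩q⁺ (lookup⇒[]= (encode c) (Fs i) ∈Fsi , lookup⇒[]= (encode c) (Fs j) ∈Fsj))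
    exclusive : ¬ (∃ λ i → ∃ λ j → i < j × Nonempty (F ∩ Fs i ∩ Fs j)) →
                ∀ c → external c ≡ true → ∀ {i j} →
                lookup (Fs i) (encode c) ≡ true → lookup (Fs j) (encode c) ≡ true → i ≡ j
    exclusive ¬shared c ext {i} {j} ∈Fsi ∈Fsj = by-trichotomy (Fin.<-cmp i j)
      where
      by-trichotomy : Tri (i < j) (i ≡ j) (j < i) → i ≡ j
      by-trichotomy (tri< i<j _ _) = ⊥-elim (¬shared (i , j , i<j , encode c , ∈F∩∩ c ext ∈Fsi ∈Fsj))
      by-trichotomy (tri≈ _ i≡j _) = i≡j
      by-trichotomy (tri> _ _ j<i) = ⊥-elim (¬shared (j , i , j<i , encode c , ∈F∩∩ c ext ∈Fsj ∈Fsi))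

theorem5 : (k : ℕ) → 1 ≤ k →
    Σ Graph λ G → IsRGraph (2 * k + 1) G ×
      Σ (Subset (Graph.m G)) λ F → PerfectMatching G F ×
        ((Fs : Fin (2 * k) → Subset (Graph.m G)) →
          (∀ i → PerfectMatching G (Fs i)) →
          ∃ λ i → ∃ λ j → i < j × Nonempty (F ∩ Fs i ∩ Fs j))
theorem5 (suc k′) _ = G , (connected , regular , odd-cut) , F , F-perfect , F-shared
  where open Construction k′
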